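{- Let $n\ge1$. The map $T\circ\Phi_F$ is a bijection from the set of recurrent configurations on the fan graph $F_n$ to the set of subgraphs $(V,E)$ of the path graph $P_n$ with $n\in V$. Moreover, for every recurrent configuration $c$ on $F_n$, $\mathrm{level}(c)$ equals the number of edges of $T(\Phi_F(c))$.
   Context: The path graph $P_n$ has vertex set $[n]$ and edges $\{i,i+1\}$, $i\in[n-1]$. The fan graph $F_n$ has vertex set $\{0,1,\dots,n\}$, the edges of $P_n$, and an edge $\{0,i\}$ for each $i\in[n]$; $0$ is the sink. A subgraph of $P_n$ is a pair $(V,E)$ with $V\subseteq[n]$ non-empty and $E$ a set of edges of $P_n$ with both endpoints in $V$. Abelian sandpile model (ASM): a configuration on $F_n$ is $c\in\mathbb{Z}_{\ge0}^n$, stable if $c_i<\deg(i)$ for all $i\in[n]$. Toppling an unstable vertex $i$ removes $\deg(i)$ grains from $i$ and gives one to each neighbour (grains sent to $0$ are lost); repeated toppling gives a unique stabilisation. With a distribution $\mu$ on $[n]$, all $\mu_i>0$, the Markov chain on stable configurations adds a grain at $i$ with probability $\mu_i$ and stabilises; recurrent configurations are the recurrent states of this chain. The level of $c$ is $\sum_ic_i+\deg(0)-|E(F_n)|=\sum_ic_i-n+1$. The map $\Phi_F$: for recurrent $c$ on $F_n$, orient the edges $\{i,i+1\}$, $0\le i\le n-1$, of the path with vertices $0,1,\dots,n$ and mark some vertices as follows. Orient $1\to0$. For $i=1,\dots,n-1$, given the orientation of $\{i-1,i\}$: if it is $i\to i-1$, orient $i\to i+1$ when $c_i=0$, and otherwise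 orient $i+1\to i$ and mark $i$ if $c_i=2$; if it is $i-1\to i$, orient $i\to i+1$ when $c_i=1$ and $i+1\to i$ when $c_i=2$ (the case $c_i=0$ does not occur for recurrent $c$). Finally mark $n$ if $\{n-1,n\}$ is oriented $n\to n-1$ and $c_n=1$. Then $\Phi_F(c)=w_1\cdots w_{n-1}$ where $w_i=R$ if $i\to i+1$, $w_i=L^m$ if $i+1\to i$ and $i+1$ is marked, and $w_i=L^u$ if $i+1\to i$ and $i+1$ is unmarked. A properly-marked $\{L,R\}$-word is a word over $\{L^u,L^m,R\}$ in which every occurrence of $L^m$ is either the last letter or is immediately followed by $L^u$ or $L^m$. For such a word $w=w_1\cdots w_{n-1}$, $T(w)$ is the subgraph of $P_n$ with vertex set $\{i\in[n-1]: w_i\in\{L^u,L^m\}\}\cup\{n\}$ and edge set $\{\{i,i+1\}: w_i=L^m\}$. -}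

module Defs where

open import Data.Nat using (ℕ; zero; suc; _+_; _∸_; _≤_; _<_; _≡ᵇ_; _<ᵇ_)
open import Data.Bool using (Bool; true; false; if_then_else_; _∨_; _∧_)
open import Data.Fin using (Fin; toℕ; fromℕ; inject₁)
import Data.Fin as Fin
open import Data.Vec using (Vec; []; _∷_; _∷ʳ_; tabulate; map; sum)
open import Data.Fin.Subset using (Subset; _∈_; ∣_∣)
open import Data.Product using (Σ; _×_; _,_; ∃)
open import Data.Integer using (ℤ; +_)
import Data.Integer as ℤ
open import Relation.Binary.PropositionalEquality using (_≡_)

-- Fan graph F_n with n = suc m.  Non-sink vertex k ∈ [n] is represented
-- by the index  i : Fin (suc m)  with  toℕ i = k - 1.  The sink 0 is
-- implicit.

Config : ℕ → Set
Config m = Fin (suc m) → ℕ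

_≗_ : ∀ {m} → Config m → Config m → Set
c ≗ d = ∀ i → c i ≡ d i

nb : ∀ {m} → Fin (suc m) → Fin (suc m) → ℕ
nb i j = if (suc (toℕ i) ≡ᵇ toℕ j) ∨ (suc (toℕ j) ≡ᵇ toℕ i) then 1 else 0

-- degree in F_n: edge to the sink plus path neighbours
deg : ∀ {m} → Fin (suc m) → ℕ
deg {m} i = 1 + (if 0 <ᵇ toℕ i then 1 else 0) + (if toℕ i <ᵇ m then 1 else 0)

Stable : ∀ {m} → Config m → Set
Stable c = ∀ i → c i < deg i

-- toppling vertex i (legal when deg i ≤ c i); grains to the sink are lost
topple : ∀ {m} → Fin (suc m) → Config m → Config m
topple i c j = if toℕ i ≡ᵇ toℕ j then c j ∸ deg i else c j + nb i j

addGrain : ∀ {m} → Fin (suc m) → Config m → Config m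
addGrain i c j = if toℕ i ≡ᵇ toℕ j then suc (c j) else c j

data TopplesTo {m} : Config m → Config m → Set where
  done : ∀ {c d} → c ≗ d → TopplesTo c d
  step : ∀ {c d} (i : Fin (suc m)) → deg i ≤ c i → TopplesTo (topple i c) d → TopplesTo c d

Stabilises : ∀ {m} → Config m → Config m → Set
Stabilises c d = TopplesTo c d × Stable d

-- one transition of the sandpile Markov chain with positive probability
-- (every μ_i > 0, so a grain may be added at any vertex)
ChainStep : ∀ {m} → Config m → Config m → Set
ChainStep {m} c d = Σ (Fin (suc m)) λ i → Stabilises (addGrain i c) d

data Reach {m} : Config m → Config m → Set where
  here  : ∀ {c d} → c ≗ d → Reach c d
  there : ∀ {c d e} → ChainStep c d → Reach d e → Reach c e

-- recurrent state of the (finite) Markov chain on stable configurations: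
-- every state accessible from c leads back to c
Recurrent : ∀ {m} → Config m → Set
Recurrent c = Stable c × (∀ d → Stable d → Reach c d → Reach d c)

-- level(c) = Σ c_i + deg(0) - |E(F_n)| = Σ c_i - n + 1
level : ∀ {m} → Config m → ℤ
level {m} c = (+ sum (tabulate c) ℤ.- + suc m) ℤ.+ + 1

data Letter : Set where
  Lu Lm R : Letter

-- orientation of an edge {i, i+1}:  toRight = i → i+1,  toLeft = i+1 → i
data Dir : Set where
  toLeft toRight : Dir

-- orientation of {i,i+1} from orientation of {i-1,i} and c_i
next : Dir → ℕ → Dir
next toLeft  zero          = toRight
next toLeft  (suc _)       = toLeft
next toRight 1             = toRight
next toRight 2             = toLeft
next toRight _             = toRight   -- does not occur for recurrent c

isLeft : Dir → Bool
isLeft toLeft  = true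
isLeft toRight = false

isEmpty : ∀ {A : Set} {k} → Vec A k → Bool
isEmpty []      = true
isEmpty (_ ∷ _) = false

-- mark of vertex j given orientation d of {j-1,j}, c_j, and whether j = n
markOf : Dir → ℕ → Bool → Bool
markOf d cj last = isLeft d ∧ (if last then cj ≡ᵇ 1 else cj ≡ᵇ 2)

letter : Dir → Bool → Letter
letter toRight _     = R
letter toLeft  true  = Lm
letter toLeft  false = Lu

-- phi d (c_i ∷ … ∷ c_n) with d the orientation of {i-1,i} produces w_i ⋯ w_{n-1}
phi : ∀ {k} → Dir → Vec ℕ (suc k) → Vec Letter k
phi d (_ ∷ [])             = []
phi d (ci ∷ cj ∷ rest) =
  letter (next d ci) (markOf (next d ci) cj (isEmpty rest)) ∷ phi (next d ci) (cj ∷ rest)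

-- edge {0,1} is oriented 1 → 0
ΦF : ∀ {m} → Config m → Vec Letter m
ΦF c = phi toLeft (tabulate c)

-- Subgraphs of P_n (n = suc m): vertex set V ⊆ [n] as Subset (suc m)
-- (index i = vertex i+1), edge set E as Subset m (index i = edge {i+1,i+2}).

isL : Letter → Bool
isL Lu = true
isL Lm = true
isL R  = false

isLm : Letter → Bool
isLm Lm = true
isLm _  = false

T : ∀ {m} → Vec Letter m → Subset (suc m) × Subset m
T w = (map isL w ∷ʳ true) , map isLm w

-- (V,E) is a subgraph of P_n: every edge has both endpoints in V
-- (V non-empty is implied by n ∈ V below)
IsSubgraph : ∀ {m} → Subset (suc m) → Subset m → Set
IsSubgraph V E = ∀ i → i ∈ E → (inject₁ i ∈ V) × (Fin.suc i ∈ V)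

IsTargetSubgraph : ∀ {m} → Subset (suc m) × Subset m → Set
IsTargetSubgraph {m} (V , E) = IsSubgraph V E × (fromℕ m ∈ V)

Subset′ : ℕ → Set
Subset′ m = Subset (suc m) × Subset m

{-# OPTIONS --safe #-}

-- A stable configuration on the fan is recurrent iff it has no forbidden interval:
-- two zeros with only 0s and 1s between them.  Such an interval survives every chain step
-- backwards and the maximal stable configuration has none, so recurrent configurations have none.
-- Conversely every stable configuration reaches the maximal one by adding grains, one grain then
-- sets off an avalanche down to (1, …, 1, 0), and any stable configuration without forbidden
-- interval is reached from there by repeatedly un-firing one of its zeros, which lowers the
-- weight Σ 3^i c_i.
--
-- Read as an automaton, Φ_F meets its excluded case exactly at a forbidden interval.  On recurrent
-- configurations it is inverted by reading each c_i off the letters of the two edges at i, and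
-- the words obtained are exactly the properly marked ones, which T maps bijectively onto the
-- subgraphs containing n.  Finally c_i + [w_{i-1} ∈ L] = 1 + [i marked] + [w_i ∈ L] for every i < n,
-- and summing this telescopes to level(c) = #L^m.

module Submission where

open import Defs
open import Data.Nat using (ℕ; zero; suc; _+_; _*_; _∸_; _^_; _≤_; _<_; z≤n; s≤s; z<s; _≡ᵇ_; _<ᵇ_; _<?_)
open import Data.Nat.Properties
open import Data.Nat.Induction using (<-wellFounded)
open import Data.Nat.Tactic.RingSolver using (solve-∀)
open import Data.Bool as Bool using (Bool; true; false; if_then_else_; _∧_; _∨_)
open import Data.Bool.Properties using (T-∨; ∧-zeroʳ; ∧-conicalˡ; ∧-conicalʳ)
open import Data.Fin as F using (Fin; toℕ; fromℕ<)
open import Data.Fin.Properties using (toℕ-inject₁; toℕ-injective; toℕ-fromℕ<; toℕ<n; any?)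
open import Data.Fin.Subset using (∣_∣)
open import Data.Vec as V using (Vec; []; _∷_; tabulate; lookup; _[_]=_; here; there)
open import Data.Vec.Properties using ([]=⇒lookup; lookup∘tabulate; tabulate∘lookup; ∷-injectiveˡ; ∷-injectiveʳ)
open import Data.Integer as ℤ using (ℤ; +_)
open import Data.Integer.Properties using (pos-+)
import Data.Integer.Tactic.RingSolver as ℤ-Solver
open import Data.Product as Product using (Σ; ∃₂; _×_; _,_; proj₁; proj₂)
open import Data.Sum as Sum using (_⊎_; inj₁; inj₂; [_,_]′)
open import Data.Unit using (⊤; tt)
open import Data.Empty using (⊥; ⊥-elim)
open import Function using (_∘_)
open import Function.Bundles using (Equivalence)
open import Induction.WellFounded using (Acc; acc)
open import Relation.Nullary using (¬_; yes; no)
open import Relation.Nullary.Decidable using (_×-dec_; dec-false)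
open import Relation.Binary.PropositionalEquality hiding (_≗_)
open import Relation.Binary.Definitions using (tri<; tri≈; tri>)
open import Algebra.Properties.CommutativeMonoid.Sum +-0-commutativeMonoid
  using (sum; sum-remove; sum-replicate-zero; sum-cong-≗; ∑-distrib-+)

if-true : ∀ {A : Set} {b} {x y : A} → Bool.T b → (if b then x else y) ≡ x
if-true {b = true} _ = refl

if-false : ∀ {A : Set} {b} {x y : A} → ¬ Bool.T b → (if b then x else y) ≡ y
if-false {b = true}  ¬b = ⊥-elim (¬b tt)
if-false {b = false} _  = refl

≡ᵇ≡false⇒≢ : ∀ {x y} → (x ≡ᵇ y) ≡ false → x ≢ y
≡ᵇ≡false⇒≢ {x} {y} eq x≡y = subst Bool.T eq (≡⇒≡ᵇ x y x≡y)

≤-zero : ∀ {x y} → x ≤ y → y ≡ 0 → x ≡ 0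
≤-zero x≤y refl = n≤0⇒n≡0 x≤y

sum-mono-≤ : ∀ {n} {f g : Fin n → ℕ} → (∀ j → f j ≤ g j) → sum f ≤ sum g
sum-mono-≤ {zero}  _   = z≤n
sum-mono-≤ {suc n} f≤g = +-mono-≤ (f≤g F.zero) (sum-mono-≤ (f≤g ∘ F.suc))

sum-mono-< : ∀ {n} {f g : Fin n → ℕ} → (∀ j → f j ≤ g j) → ∀ i → f i < g i → sum f < sum g
sum-mono-< f≤g F.zero    fi<gi = +-mono-<-≤ fi<gi (sum-mono-≤ (f≤g ∘ F.suc))
sum-mono-< f≤g (F.suc i) fi<gi = +-mono-≤-< (f≤g F.zero) (sum-mono-< (f≤g ∘ F.suc) i fi<gi)

term≤sum : ∀ {n} (f : Fin (suc n) → ℕ) i → f i ≤ sum f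
term≤sum f i = ≤-trans (m≤m+n (f i) _) (≤-reflexive (sym (sum-remove {i = i} f)))

sum-indicator : ∀ {n} (p : Fin n) x → sum (λ (j : Fin n) → if toℕ p ≡ᵇ toℕ j then x else 0) ≡ x
sum-indicator {suc n} F.zero    x = trans (cong (_+_ x) (sum-replicate-zero n)) (+-identityʳ x)
sum-indicator         (F.suc p) x = sum-indicator p x

Adjacent : ℕ → ℕ → Set
Adjacent a b = b ≡ suc a ⊎ a ≡ suc b

Distant : ℕ → ℕ → Set
Distant a b = suc a < b ⊎ suc b < a

adjacent⇒≢ : ∀ {a b} → Adjacent a b → a ≢ b
adjacent⇒≢ (inj₁ b≡1+a) refl = 1+n≢n (sym b≡1+a)
adjacent⇒≢ (inj₂ a≡1+b) refl = 1+n≢n (sym a≡1+b)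

distant⇒≢ : ∀ {a b} → Distant a b → a ≢ b
distant⇒≢ (inj₁ 1+a<b) refl = <-asym (n<1+n _) 1+a<b
distant⇒≢ (inj₂ 1+b<a) refl = <-asym (n<1+n _) 1+b<a

distant⇒¬adjacent : ∀ {a b} → Distant a b → ¬ Adjacent a b
distant⇒¬adjacent (inj₁ 1+a<b) (inj₁ refl) = <-irrefl refl 1+a<b
distant⇒¬adjacent (inj₁ 1+a<b) (inj₂ refl) = <-asym (<-trans (n<1+n _) 1+a<b) (n<1+n _)
distant⇒¬adjacent (inj₂ 1+b<a) (inj₁ refl) = <-asym (<-trans (n<1+n _) 1+b<a) (n<1+n _)
distant⇒¬adjacent (inj₂ 1+b<a) (inj₂ refl) = <-irrefl refl 1+b<a

indicator : Bool → ℕ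
indicator b = if b then 1 else 0

indicator≤1 : ∀ b → indicator b ≤ 1
indicator≤1 true  = ≤-refl
indicator≤1 false = z≤n

-- Toppling and the Markov chain

-- deg i reduces to suc (maxStable i)
maxStable : ∀ {m} → Config m
maxStable {m} i = indicator (0 <ᵇ toℕ i) + indicator (toℕ i <ᵇ m)

module _ {m : ℕ} where

  maxStable-stable : Stable (maxStable {m})
  maxStable-stable _ = ≤-refl

  maxStable≤2 : (i : Fin (suc m)) → maxStable i ≤ 2
  maxStable≤2 i = +-mono-≤ (indicator≤1 (0 <ᵇ toℕ i)) (indicator≤1 (toℕ i <ᵇ m))

  maxStable-positive : (i : Fin (suc m)) → toℕ i < m → 1 ≤ maxStable i
  maxStable-positive i i<m rewrite if-true {x = 1} {y = 0} (<⇒<ᵇ i<m) = m≤n+m 1 _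

  maxStable-interior : (i : Fin (suc m)) → 0 < toℕ i → toℕ i < m → maxStable i ≡ 2
  maxStable-interior i 0<i i<m rewrite if-true {x = 1} {y = 0} (<⇒<ᵇ 0<i) | if-true {x = 1} {y = 0} (<⇒<ᵇ i<m) = refl

  nb-adjacent : {i j : Fin (suc m)} → Adjacent (toℕ i) (toℕ j) → nb i j ≡ 1
  nb-adjacent adj = if-true (Equivalence.from T-∨ (Sum.map (≡⇒≡ᵇ _ _ ∘ sym) (≡⇒≡ᵇ _ _ ∘ sym) adj))

  nb-distant : {i j : Fin (suc m)} → Distant (toℕ i) (toℕ j) → nb i j ≡ 0
  nb-distant far =
    if-false (distant⇒¬adjacent far ∘ Sum.map (sym ∘ ≡ᵇ⇒≡ _ _) (sym ∘ ≡ᵇ⇒≡ _ _) ∘ Equivalence.to T-∨)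

  nb-self : (i : Fin (suc m)) → nb i i ≡ 0
  nb-self i = if-false ([ 1+i≢i , 1+i≢i ]′ ∘ Equivalence.to T-∨)
    where
    1+i≢i : ¬ Bool.T (suc (toℕ i) ≡ᵇ toℕ i)
    1+i≢i = 1+n≢n ∘ ≡ᵇ⇒≡ (suc (toℕ i)) (toℕ i)

  nb≢0⇒adjacent : {i j : Fin (suc m)} → nb i j ≢ 0 → Adjacent (toℕ i) (toℕ j)
  nb≢0⇒adjacent {i} {j} nb≢0 with (suc (toℕ i) ≡ᵇ toℕ j) ∨ (suc (toℕ j) ≡ᵇ toℕ i) in adj
  ... | true  = Sum.map (sym ∘ ≡ᵇ⇒≡ _ _) (sym ∘ ≡ᵇ⇒≡ _ _) (Equivalence.to T-∨ (subst Bool.T (sym adj) tt))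
  ... | false = ⊥-elim (nb≢0 refl)

  nb≤1 : (i j : Fin (suc m)) → nb i j ≤ 1
  nb≤1 i j = indicator≤1 _

  topple-self : (i : Fin (suc m)) (c : Config m) → topple i c i ≡ c i ∸ deg i
  topple-self i c = if-true (≡⇒≡ᵇ (toℕ i) (toℕ i) refl)

  topple-other : {i j : Fin (suc m)} (c : Config m) → toℕ i ≢ toℕ j → topple i c j ≡ c j + nb i j
  topple-other c i≢j = if-false (i≢j ∘ ≡ᵇ⇒≡ _ _)

  topple-other-≥ : {i j : Fin (suc m)} (c : Config m) → toℕ i ≢ toℕ j → c j ≤ topple i c j
  topple-other-≥ {j = j} c i≢j = subst (c j ≤_) (sym (topple-other c i≢j)) (m≤m+n (c j) _)

  topple-adjacent : {i j : Fin (suc m)} (c : Config m) → Adjacent (toℕ i) (toℕ j) → topple i c j ≡ suc (c j)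
  topple-adjacent {j = j} c adj =
    trans (topple-other c (adjacent⇒≢ adj)) (trans (cong (_+_ (c j)) (nb-adjacent adj)) (+-comm (c j) 1))

  topple-distant : {i j : Fin (suc m)} (c : Config m) → Distant (toℕ i) (toℕ j) → topple i c j ≡ c j
  topple-distant {j = j} c far =
    trans (topple-other c (distant⇒≢ far)) (trans (cong (_+_ (c j)) (nb-distant far)) (+-identityʳ (c j)))

  addGrain-self : (i : Fin (suc m)) (c : Config m) → addGrain i c i ≡ suc (c i)
  addGrain-self i c = if-true (≡⇒≡ᵇ (toℕ i) (toℕ i) refl)

  addGrain-other : {i j : Fin (suc m)} (c : Config m) → toℕ i ≢ toℕ j → addGrain i c j ≡ c j
  addGrain-other c i≢j = if-false (i≢j ∘ ≡ᵇ⇒≡ _ _)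

  addGrain-≥ : (i j : Fin (suc m)) (c : Config m) → c j ≤ addGrain i c j
  addGrain-≥ i j c with toℕ i ≡ᵇ toℕ j
  ... | true  = n≤1+n (c j)
  ... | false = ≤-refl

  topple-cong : (i : Fin (suc m)) {c d : Config m} → c ≗ d → topple i c ≗ topple i d
  topple-cong i c≗d j = cong (λ x → if toℕ i ≡ᵇ toℕ j then x ∸ deg i else x + nb i j) (c≗d j)

  addGrain-cong : (i : Fin (suc m)) {c d : Config m} → c ≗ d → addGrain i c ≗ addGrain i d
  addGrain-cong i c≗d j = cong (λ x → if toℕ i ≡ᵇ toℕ j then suc x else x) (c≗d j)

  TopplesTo-≗ : {c c′ d : Config m} → c ≗ c′ → TopplesTo c′ d → TopplesTo c d
  TopplesTo-≗ c≗c′ (done c′≗d)  = done (λ j → trans (c≗c′ j) (c′≗d j))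
  TopplesTo-≗ c≗c′ (step i le t) =
    step i (subst (deg i ≤_) (sym (c≗c′ i)) le) (TopplesTo-≗ (topple-cong i c≗c′) t)

  Reach-≗ : {c c′ d : Config m} → c ≗ c′ → Reach c′ d → Reach c d
  Reach-≗ c≗c′ (here c′≗d)             = here (λ j → trans (c≗c′ j) (c′≗d j))
  Reach-≗ c≗c′ (there (i , t , st) r) = there (i , TopplesTo-≗ (addGrain-cong i c≗c′) t , st) r

  Reach-trans : {c d e : Config m} → Reach c d → Reach d e → Reach c e
  Reach-trans (here c≗d)  r = Reach-≗ c≗d r
  Reach-trans (there s r) r′ = there s (Reach-trans r r′)

  ChainStep⇒Reach : {c d : Config m} → ChainStep c d → Reach c d
  ChainStep⇒Reach s = there s (here (λ _ → refl))

-- Forbidden subconfigurations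

-- The interval [a, b] is a forbidden subconfiguration: each of its vertices holds
-- fewer grains than it has neighbours inside the interval.
ForbiddenBetween : ∀ {m} → Config m → Fin (suc m) → Fin (suc m) → Set
ForbiddenBetween c a b =
  toℕ a < toℕ b × c a ≡ 0 × c b ≡ 0 × (∀ i → toℕ a < toℕ i → toℕ i < toℕ b → c i ≤ 1)

Forbidden : ∀ {m} → Config m → Set
Forbidden c = ∃₂ (ForbiddenBetween c)

module _ {m : ℕ} where

  forbiddenBetween-sub : {c d : Config m} {a b a′ b′ : Fin (suc m)} →
    toℕ a ≤ toℕ a′ → toℕ b′ ≤ toℕ b → toℕ a′ < toℕ b′ → c a′ ≡ 0 → c b′ ≡ 0 →
    (∀ i → toℕ a′ < toℕ i → toℕ i < toℕ b′ → c i ≤ d i) →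
    ForbiddenBetween d a b → ForbiddenBetween c a′ b′
  forbiddenBetween-sub a≤a′ b′≤b a′<b′ ca′ cb′ c≤d (_ , _ , _ , inner) =
    a′<b′ , ca′ , cb′ , λ i a′<i i<b′ →
      ≤-trans (c≤d i a′<i i<b′) (inner i (≤-<-trans a≤a′ a′<i) (<-≤-trans i<b′ b′≤b))

  forbiddenBetween-mono : {c d : Config m} {a b : Fin (suc m)} →
    (∀ i → toℕ a ≤ toℕ i → toℕ i ≤ toℕ b → c i ≤ d i) →
    ForbiddenBetween d a b → ForbiddenBetween c a b
  forbiddenBetween-mono {a = a} {b} c≤d f@(a<b , da , db , _) =
    forbiddenBetween-sub ≤-refl ≤-refl a<b
      (≤-zero (c≤d a ≤-refl (<⇒≤ a<b)) da) (≤-zero (c≤d b (<⇒≤ a<b) ≤-refl) db)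
      (λ i a<i i<b → c≤d i (<⇒≤ a<i) (<⇒≤ i<b)) f

  forbidden-mono : {c d : Config m} → (∀ i → c i ≤ d i) → Forbidden d → Forbidden c
  forbidden-mono c≤d (a , b , f) = a , b , forbiddenBetween-mono (λ i _ _ → c≤d i) f

  forbiddenBetween-adjacent : {c : Config m} {a b : Fin (suc m)} →
    toℕ b ≡ suc (toℕ a) → c a ≡ 0 → c b ≡ 0 → ForbiddenBetween c a b
  forbiddenBetween-adjacent b≡1+a ca cb =
    ≤-reflexive (sym b≡1+a) , ca , cb , λ i a<i i<b → ⊥-elim (<⇒≱ i<b (subst (_≤ toℕ i) (sym b≡1+a) a<i))

  topple-adjacent-≢0 : {v j : Fin (suc m)} (c : Config m) → Adjacent (toℕ v) (toℕ j) → topple v c j ≢ 0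
  topple-adjacent-≢0 c adj c′j≡0 = 1+n≢0 (trans (sym (topple-adjacent c adj)) c′j≡0)

  topple-adjacent-≤1 : {v j : Fin (suc m)} (c : Config m) → Adjacent (toℕ v) (toℕ j) → topple v c j ≤ 1 → c j ≡ 0
  topple-adjacent-≤1 c adj c′j≤1 = n≤0⇒n≡0 (≤-pred (subst (_≤ 1) (topple-adjacent c adj) c′j≤1))

  vertexAfter : {a b : Fin (suc m)} → toℕ a < toℕ b → Σ (Fin (suc m)) λ a′ → toℕ a′ ≡ suc (toℕ a)
  vertexAfter {b = b} a<b = fromℕ< 1+a<1+m , toℕ-fromℕ< 1+a<1+m
    where 1+a<1+m = ≤-trans (s≤s a<b) (toℕ<n b)

  vertexBefore : {a v : Fin (suc m)} → toℕ a < toℕ v → Σ (Fin (suc m)) λ u → toℕ v ≡ suc (toℕ u)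
  vertexBefore {v = F.suc u} _ = F.inject₁ u , cong suc (sym (toℕ-inject₁ u))

  untopple-left : {v a b : Fin (suc m)} (c : Config m) → toℕ v ≡ toℕ a →
    ForbiddenBetween (topple v c) a b → Forbidden c
  untopple-left {v} {a} {b} c v≡a f@(a<b , _ , c′b , inner) =
    a′ , b , forbiddenBetween-sub (<⇒≤ a<a′) ≤-refl a′<b ca′ cb
                 (λ i a′<i _ → topple-other-≥ c (v≢ (<-trans a<a′ a′<i))) f
    where
    a′ : Fin (suc m)
    a′ = proj₁ (vertexAfter a<b)
    a′≡1+a : toℕ a′ ≡ suc (toℕ a)
    a′≡1+a = proj₂ (vertexAfter a<b)
    a<a′ : toℕ a < toℕ a′
    a<a′ = ≤-reflexive (sym a′≡1+a)
    v≢ : ∀ {i} → toℕ a < toℕ i → toℕ v ≢ toℕ i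
    v≢ {i} a<i = <⇒≢ (subst (_< toℕ i) (sym v≡a) a<i)
    adj : ∀ {i} → toℕ i ≡ toℕ a′ → Adjacent (toℕ v) (toℕ i)
    adj i≡a′ = inj₁ (trans i≡a′ (trans a′≡1+a (cong suc (sym v≡a))))
    a′<b : toℕ a′ < toℕ b
    a′<b = ≤∧≢⇒< (subst (_≤ toℕ b) (sym a′≡1+a) a<b)
                 (λ a′≡b → topple-adjacent-≢0 c (adj (sym a′≡b)) c′b)
    ca′ : c a′ ≡ 0
    ca′ = topple-adjacent-≤1 c (adj refl) (inner a′ a<a′ a′<b)
    cb : c b ≡ 0
    cb = ≤-zero (topple-other-≥ c (v≢ a<b)) c′b

  untopple-inside : {v a b : Fin (suc m)} (c : Config m) → toℕ a < toℕ v → toℕ v ≤ toℕ b →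
    ForbiddenBetween (topple v c) a b → Forbidden c
  untopple-inside {v} {a} {b} c a<v v≤b f@(_ , c′a , _ , inner) =
    a , u , forbiddenBetween-sub ≤-refl (<⇒≤ u<b) a<u ca cu (λ i _ i<u → topple-other-≥ c (>⇒≢ (<-trans i<u u<v))) f
    where
    u : Fin (suc m)
    u = proj₁ (vertexBefore a<v)
    v≡1+u : toℕ v ≡ suc (toℕ u)
    v≡1+u = proj₂ (vertexBefore a<v)
    u<v : toℕ u < toℕ v
    u<v = ≤-reflexive (sym v≡1+u)
    u<b : toℕ u < toℕ b
    u<b = <-≤-trans u<v v≤b
    a<u : toℕ a < toℕ u
    a<u = ≤∧≢⇒< (≤-pred (subst (toℕ a <_) v≡1+u a<v))
                (λ a≡u → topple-adjacent-≢0 c (inj₂ (trans v≡1+u (cong suc (sym a≡u)))) c′a)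
    ca : c a ≡ 0
    ca = ≤-zero (topple-other-≥ c (>⇒≢ a<v)) c′a
    cu : c u ≡ 0
    cu = topple-adjacent-≤1 c (inj₂ v≡1+u) (inner u a<u u<b)

  forbidden-untopple : (v : Fin (suc m)) (c : Config m) → Forbidden (topple v c) → Forbidden c
  forbidden-untopple v c (a , b , f) with <-cmp (toℕ v) (toℕ a) | <-cmp (toℕ v) (toℕ b)
  ... | tri< v<a _ _ | _ = a , b , forbiddenBetween-mono (λ i a≤i _ → topple-other-≥ c (<⇒≢ (<-≤-trans v<a a≤i))) f
  ... | tri≈ _ v≡a _ | _ = untopple-left c v≡a f
  ... | tri> _ _ a<v | tri< v<b _ _ = untopple-inside c a<v (<⇒≤ v<b) f
  ... | tri> _ _ a<v | tri≈ _ v≡b _ = untopple-inside c a<v (≤-reflexive v≡b) f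
  ... | tri> _ _ _   | tri> _ _ b<v =
    a , b , forbiddenBetween-mono (λ i _ i≤b → topple-other-≥ c (>⇒≢ (≤-<-trans i≤b b<v))) f

  TopplesTo-reflects-forbidden : {c d : Config m} → TopplesTo c d → Forbidden d → Forbidden c
  TopplesTo-reflects-forbidden (done c≗d)   = forbidden-mono (≤-reflexive ∘ c≗d)
  TopplesTo-reflects-forbidden {c} (step i _ t) = forbidden-untopple i c ∘ TopplesTo-reflects-forbidden t

  Reach-reflects-forbidden : {c d : Config m} → Reach c d → Forbidden d → Forbidden c
  Reach-reflects-forbidden (here c≗d) = forbidden-mono (≤-reflexive ∘ c≗d)
  Reach-reflects-forbidden {c} (there (i , t , _) r) =
    forbidden-mono (λ j → addGrain-≥ i j c) ∘ TopplesTo-reflects-forbidden t ∘ Reach-reflects-forbidden r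

  maxStable-unforbidden : ¬ Forbidden (maxStable {m})
  maxStable-unforbidden (a , b , a<b , maxa≡0 , _) =
    1+n≢0 (≤-zero (maxStable-positive a (<-≤-trans a<b (≤-pred (toℕ<n b)))) maxa≡0)

-- Recurrence is the absence of forbidden subconfigurations

onesThenZero : ∀ {m} → Config m
onesThenZero {m} j = indicator (toℕ j <ᵇ m)

module _ {m : ℕ} where

  reach-≥ : {c d : Config m} → (∀ j → c j ≤ d j) → Stable d → Reach c d
  reach-≥ {c} {d} c≤d st = go (<-wellFounded (deficit c)) c≤d
    where
    deficit : Config m → ℕ
    deficit c = sum (λ j → d j ∸ c j)
    go : ∀ {c} → Acc _<_ (deficit c) → (∀ j → c j ≤ d j) → Reach c d
    go {c} (acc smaller) c≤d with any? (λ j → c j <? d j)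
    ... | no ∄< = here (λ j → ≤-antisym (c≤d j) (≮⇒≥ (λ cj<dj → ∄< (j , cj<dj))))
    ... | yes (i , ci<di) =
      there (i , done (λ _ → refl) , λ j → ≤-<-trans (c′≤d j) (st j)) (go (smaller deficit-decreases) c′≤d)
      where
      c′≤d : ∀ j → addGrain i c j ≤ d j
      c′≤d j with toℕ i ≟ toℕ j
      ... | no i≢j = subst (_≤ d j) (sym (addGrain-other c i≢j)) (c≤d j)
      ... | yes i≡j with toℕ-injective i≡j
      ...   | refl = subst (_≤ d i) (sym (addGrain-self i c)) ci<di
      deficit-decreases : deficit (addGrain i c) < deficit c
      deficit-decreases = sum-mono-< (λ j → ∸-monoʳ-≤ (d j) (addGrain-≥ i j c)) i
        (subst (λ x → d i ∸ x < d i ∸ c i) (sym (addGrain-self i c)) (∸-monoʳ-< (n<1+n (c i)) ci<di))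

  onesThenZero-stable : Stable (onesThenZero {m})
  onesThenZero-stable j with toℕ j <? m
  ... | yes j<m = s≤s (subst (_≤ maxStable j) (sym (if-true (<⇒<ᵇ j<m))) (maxStable-positive j j<m))
  ... | no  j≮m = s≤s (subst (_≤ maxStable j) (sym (if-false (j≮m ∘ <ᵇ⇒< _ _))) z≤n)

  -- A grain added at the first vertex of maxStable topples every vertex once, from left to right;
  -- this is the configuration after the first k topplings.
  avalanche : ℕ → Config m
  avalanche k j =
    if suc (toℕ j) <ᵇ k then 1
    else if suc (toℕ j) ≡ᵇ k then 0
    else if toℕ j ≡ᵇ k then suc (maxStable j)
    else maxStable j

  avalanche-behind : ∀ k (j : Fin (suc m)) → suc (toℕ j) < k → avalanche k j ≡ 1
  avalanche-behind k j 1+j<k = if-true (<⇒<ᵇ 1+j<k)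

  avalanche-last : ∀ k (j : Fin (suc m)) → suc (toℕ j) ≡ k → avalanche k j ≡ 0
  avalanche-last k j 1+j≡k =
    trans (if-false (<-irrefl 1+j≡k ∘ <ᵇ⇒< (suc (toℕ j)) k)) (if-true (≡⇒≡ᵇ _ _ 1+j≡k))

  avalanche-front : ∀ k (j : Fin (suc m)) → toℕ j ≡ k → avalanche k j ≡ suc (maxStable j)
  avalanche-front k j j≡k =
    trans (if-false (λ t → <-irrefl j≡k (<-trans (n<1+n (toℕ j)) (<ᵇ⇒< (suc (toℕ j)) k t))))
      (trans (if-false (λ t → 1+n≢n (trans (≡ᵇ⇒≡ (suc (toℕ j)) k t) (sym j≡k))))
        (if-true (≡⇒≡ᵇ _ _ j≡k)))

  avalanche-ahead : ∀ k (j : Fin (suc m)) → k < toℕ j → avalanche k j ≡ maxStable j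
  avalanche-ahead k j k<j =
    trans (if-false (λ t → <-asym k<j (<-trans (n<1+n (toℕ j)) (<ᵇ⇒< (suc (toℕ j)) k t))))
      (trans (if-false (λ t → <-irrefl (sym (≡ᵇ⇒≡ (suc (toℕ j)) k t)) (<-trans k<j (n<1+n _))))
        (if-false (λ t → <-irrefl (sym (≡ᵇ⇒≡ (toℕ j) k t)) k<j)))

  avalanche-step : ∀ k (v : Fin (suc m)) → toℕ v ≡ k → topple v (avalanche k) ≗ avalanche (suc k)
  avalanche-step k v v≡k j with <-cmp (suc (toℕ j)) k | <-cmp (toℕ j) (suc k)
  ... | tri< 1+j<k _ _ | _ =
    trans (topple-distant (avalanche k) (inj₂ (subst (suc (toℕ j) <_) (sym v≡k) 1+j<k)))
      (trans (avalanche-behind k j 1+j<k) (sym (avalanche-behind (suc k) j (<-trans 1+j<k (n<1+n k)))))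
  ... | tri≈ _ 1+j≡k _ | _ =
    trans (topple-adjacent (avalanche k) (inj₂ (trans v≡k (sym 1+j≡k))))
      (trans (cong suc (avalanche-last k j 1+j≡k)) (sym (avalanche-behind (suc k) j (s≤s (≤-reflexive 1+j≡k)))))
  ... | _ | tri> _ _ 1+k<j =
    trans (topple-distant (avalanche k) (inj₁ (subst (_< toℕ j) (cong suc (sym v≡k)) 1+k<j)))
      (trans (avalanche-ahead k j (<-trans (n<1+n k) 1+k<j)) (sym (avalanche-ahead (suc k) j 1+k<j)))
  ... | _ | tri≈ _ j≡1+k _ =
    trans (topple-adjacent (avalanche k) (inj₁ (trans j≡1+k (cong suc (sym v≡k)))))
      (trans (cong suc (avalanche-ahead k j (subst (k <_) (sym j≡1+k) (n<1+n k)))) (sym (avalanche-front (suc k) j j≡1+k)))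
  ... | tri> _ _ k<1+j | tri< j<1+k _ _
    with toℕ-injective {i = j} {v} (trans (≤-antisym (≤-pred j<1+k) (≤-pred k<1+j)) (sym v≡k))
  ...   | refl =
    trans (topple-self j (avalanche k))
      (trans (cong (_∸ deg j) (avalanche-front k j v≡k))
        (trans (n∸n≡0 (deg j)) (sym (avalanche-last (suc k) j (cong suc v≡k)))))

  avalanche-end : avalanche (suc m) ≗ onesThenZero
  avalanche-end j with <-cmp (toℕ j) m
  ... | tri< j<m _ _ = trans (avalanche-behind (suc m) j (s≤s j<m)) (sym (if-true (<⇒<ᵇ j<m)))
  ... | tri≈ _ j≡m _ = trans (avalanche-last (suc m) j (cong suc j≡m)) (sym (if-false (<-irrefl j≡m ∘ <ᵇ⇒< _ _)))
  ... | tri> _ _ m<j = ⊥-elim (<⇒≱ m<j (≤-pred (toℕ<n j)))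

  avalanche-topples : ∀ d k → d + k ≡ suc m → TopplesTo (avalanche k) onesThenZero
  avalanche-topples zero    k k≡1+m rewrite k≡1+m = done avalanche-end
  avalanche-topples (suc d) k d+k≡m =
    step v (≤-reflexive (sym (avalanche-front k v v≡k)))
      (TopplesTo-≗ (avalanche-step k v v≡k) (avalanche-topples d (suc k) (trans (+-suc d k) d+k≡m)))
    where
    k<1+m : k < suc m
    k<1+m = subst (k <_) d+k≡m (s≤s (m≤n+m k d))
    v : Fin (suc m)
    v = fromℕ< k<1+m
    v≡k : toℕ v ≡ k
    v≡k = toℕ-fromℕ< k<1+m

  maxStable-reaches-onesThenZero : Reach (maxStable {m}) onesThenZero
  maxStable-reaches-onesThenZero =
    ChainStep⇒Reach (F.zero , TopplesTo-≗ start (avalanche-topples (suc m) 0 (+-identityʳ (suc m))) , onesThenZero-stable)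
    where
    start : addGrain F.zero maxStable ≗ avalanche 0
    start F.zero    = refl
    start (F.suc j) = refl

weight : ∀ {m} → Config m → ℕ
weight c = sum (λ j → 3 ^ toℕ j * c j)

module Unfire {m : ℕ} {c : Config m} (stable : Stable c) (unforbidden : ¬ Forbidden c)
              {p : Fin (suc m)} (cp≡0 : c p ≡ 0) (p<m : toℕ p < m) where

  P : ℕ
  P = toℕ p

  unfired : Config m
  unfired j = if P ≡ᵇ toℕ j then maxStable p else c j ∸ nb p j

  adjacent-positive : ∀ {j} → Adjacent P (toℕ j) → 1 ≤ c j
  adjacent-positive {j} adj = n≢0⇒n>0 (unforbidden ∘ zeros adj)
    where
    zeros : Adjacent P (toℕ j) → c j ≡ 0 → Forbidden c
    zeros (inj₁ j≡1+p) cj≡0 = p , j , forbiddenBetween-adjacent j≡1+p cp≡0 cj≡0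
    zeros (inj₂ p≡1+j) cj≡0 = j , p , forbiddenBetween-adjacent p≡1+j cj≡0 cp≡0

  nb≤c : ∀ j → nb p j ≤ c j
  nb≤c j with nb p j ≟ 0
  ... | yes nb≡0 = subst (_≤ c j) (sym nb≡0) z≤n
  ... | no  nb≢0 = ≤-trans (nb≤1 p j) (adjacent-positive (nb≢0⇒adjacent nb≢0))

  unfired-self : unfired p ≡ maxStable p
  unfired-self = if-true (≡⇒≡ᵇ P P refl)

  unfired-other : ∀ {j} → P ≢ toℕ j → unfired j + nb p j ≡ c j
  unfired-other {j} p≢j = trans (cong (_+ nb p j) (if-false (p≢j ∘ ≡ᵇ⇒≡ _ _))) (m∸n+n≡m (nb≤c j))

  unfired-distant : ∀ {j} → Distant P (toℕ j) → unfired j ≡ c j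
  unfired-distant {j} far =
    trans (sym (+-identityʳ _)) (trans (cong (_+_ (unfired j)) (sym (nb-distant far))) (unfired-other (distant⇒≢ far)))

  unfired-adjacent : ∀ {j} → Adjacent P (toℕ j) → suc (unfired j) ≡ c j
  unfired-adjacent {j} adj =
    trans (+-comm 1 (unfired j)) (trans (cong (_+_ (unfired j)) (sym (nb-adjacent adj))) (unfired-other (adjacent⇒≢ adj)))

  unfired-stable : Stable unfired
  unfired-stable j with P ≟ toℕ j
  ... | no p≢j = ≤-<-trans (subst (unfired j ≤_) (unfired-other p≢j) (m≤m+n _ _)) (stable j)
  ... | yes p≡j with toℕ-injective p≡j
  ...   | refl = s≤s (≤-reflexive unfired-self)

  unfired-step : ChainStep unfired c
  unfired-step = p , step p (≤-reflexive (sym grown)) (done toppled) , stable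
    where
    grown : addGrain p unfired p ≡ deg p
    grown = trans (addGrain-self p unfired) (cong suc unfired-self)
    toppled : topple p (addGrain p unfired) ≗ c
    toppled j with P ≟ toℕ j
    ... | no p≢j = trans (topple-other (addGrain p unfired) p≢j)
                         (trans (cong (_+ nb p j) (addGrain-other unfired p≢j)) (unfired-other p≢j))
    ... | yes p≡j with toℕ-injective p≡j
    ...   | refl = trans (topple-self p (addGrain p unfired))
                         (trans (cong (_∸ deg p) grown) (trans (n∸n≡0 (deg p)) (sym cp≡0)))

  unfired-p≢0 : ∀ {x} → toℕ x ≡ P → unfired x ≢ 0
  unfired-p≢0 x≡p ux≡0 with toℕ-injective x≡p
  ... | refl = 1+n≢0 (≤-zero (maxStable-positive p p<m) (trans (sym unfired-self) ux≡0))

  unfired-left : ∀ {a b} → toℕ b < P → ForbiddenBetween unfired a b → Forbidden c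
  unfired-left {a} {b} b<p f@(a<b , ua≡0 , ub≡0 , inner) with suc (toℕ b) ≟ P
  ... | no 1+b≢p = a , b , forbiddenBetween-mono
          (λ i _ i≤b → ≤-reflexive (sym (unfired-distant (inj₂ (≤-<-trans (s≤s i≤b) (≤∧≢⇒< b<p 1+b≢p)))))) f
  ... | yes 1+b≡p =
    a , p , ≤-<-trans (<⇒≤ a<b) b<p ,
    trans (sym (unfired-distant (inj₂ (≤-<-trans a<b b<p)))) ua≡0 , cp≡0 , inner′
    where
    inner′ : ∀ i → toℕ a < toℕ i → toℕ i < P → c i ≤ 1
    inner′ i a<i i<p with <-cmp (toℕ i) (toℕ b)
    ... | tri< i<b _ _ = subst (_≤ 1) (unfired-distant (inj₂ (≤-<-trans i<b b<p))) (inner i a<i i<b)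
    ... | tri> _ _ b<i = ⊥-elim (<⇒≱ i<p (subst (_≤ toℕ i) 1+b≡p b<i))
    ... | tri≈ _ i≡b _ with toℕ-injective i≡b
    ...   | refl = ≤-reflexive (trans (sym (unfired-adjacent (inj₂ (sym 1+b≡p)))) (cong suc ub≡0))

  unfired-right : ∀ {a b} → P < toℕ a → ForbiddenBetween unfired a b → Forbidden c
  unfired-right {a} {b} p<a f@(a<b , ua≡0 , ub≡0 , inner) with suc P ≟ toℕ a
  ... | no 1+p≢a = a , b , forbiddenBetween-mono
          (λ i a≤i _ → ≤-reflexive (sym (unfired-distant (inj₁ (<-≤-trans (≤∧≢⇒< p<a 1+p≢a) a≤i))))) f
  ... | yes 1+p≡a =
    p , b , <-trans p<a a<b , cp≡0 ,
    trans (sym (unfired-distant (inj₁ (subst (_< toℕ b) (sym 1+p≡a) a<b)))) ub≡0 , inner′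
    where
    inner′ : ∀ i → P < toℕ i → toℕ i < toℕ b → c i ≤ 1
    inner′ i p<i i<b with <-cmp (toℕ i) (toℕ a)
    ... | tri> _ _ a<i = subst (_≤ 1) (unfired-distant (inj₁ (subst (_< toℕ i) (sym 1+p≡a) a<i))) (inner i a<i i<b)
    ... | tri< i<a _ _ = ⊥-elim (<⇒≱ i<a (subst (_≤ toℕ i) 1+p≡a p<i))
    ... | tri≈ _ i≡a _ with toℕ-injective i≡a
    ...   | refl = ≤-reflexive (trans (sym (unfired-adjacent (inj₁ (sym 1+p≡a)))) (cong suc ua≡0))

  unfired-unforbidden : ¬ Forbidden unfired
  unfired-unforbidden (a , b , f@(_ , ua≡0 , ub≡0 , inner)) with <-cmp (toℕ b) P | <-cmp P (toℕ a)
  ... | tri< b<p _ _ | _ = unforbidden (unfired-left b<p f)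
  ... | _ | tri< p<a _ _ = unforbidden (unfired-right p<a f)
  ... | tri≈ _ b≡p _ | _ = unfired-p≢0 b≡p ub≡0
  ... | _ | tri≈ _ p≡a _ = unfired-p≢0 (sym p≡a) ua≡0
  ... | tri> _ _ p<b | tri> _ _ a<p =
    <⇒≱ (≤-reflexive (sym (trans unfired-self (maxStable-interior p (≤-<-trans z≤n a<p) p<m)))) (inner p a<p p<b)

  -- The grain taken from p + 1 (weight 3^(p+1)) outweighs the at most two grains put on p (weight 3^p).
  unfired-lighter : weight unfired < weight c
  unfired-lighter = +-cancelʳ-< (3 ^ suc P) (weight unfired) (weight c) (begin-strict
    weight unfired + 3 ^ suc P      ≤⟨ +-monoʳ-≤ (weight unfired) neighbour-term ⟩
    weight unfired + pushed         ≡⟨ balance ⟩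
    weight c + 3 ^ P * maxStable p  <⟨ +-monoʳ-< (weight c) p-term ⟩
    weight c + 3 ^ suc P            ∎)
    where
    open ≤-Reasoning
    pushed : ℕ
    pushed = sum (λ j → 3 ^ toℕ j * nb p j)

    atP : Fin (suc m) → ℕ
    atP j = if P ≡ᵇ toℕ j then 3 ^ P * maxStable p else 0

    pointwise : ∀ j → 3 ^ toℕ j * unfired j + 3 ^ toℕ j * nb p j
                    ≡ 3 ^ toℕ j * c j + atP j
    pointwise j with P ≟ toℕ j
    ... | no p≢j = begin-equality
      3 ^ toℕ j * unfired j + 3 ^ toℕ j * nb p j  ≡⟨ *-distribˡ-+ (3 ^ toℕ j) _ _ ⟨
      3 ^ toℕ j * (unfired j + nb p j)            ≡⟨ cong (3 ^ toℕ j *_) (unfired-other p≢j) ⟩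
      3 ^ toℕ j * c j                             ≡⟨ +-identityʳ _ ⟨
      3 ^ toℕ j * c j + 0                         ≡⟨ cong (_+_ (3 ^ toℕ j * c j)) (if-false (p≢j ∘ ≡ᵇ⇒≡ _ _)) ⟨
      3 ^ toℕ j * c j + atP j ∎
    ... | yes p≡j with toℕ-injective p≡j
    ...   | refl = begin-equality
      3 ^ P * unfired p + 3 ^ P * nb p p  ≡⟨ cong₂ (λ x y → 3 ^ P * x + 3 ^ P * y) unfired-self (nb-self p) ⟩
      3 ^ P * maxStable p + 3 ^ P * 0     ≡⟨ cong (_+_ (3 ^ P * maxStable p)) (*-zeroʳ (3 ^ P)) ⟩
      3 ^ P * maxStable p + 0             ≡⟨ +-comm _ 0 ⟩
      0 + 3 ^ P * maxStable p             ≡⟨ cong₂ _+_ (trans (cong (3 ^ P *_) cp≡0) (*-zeroʳ (3 ^ P)))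
                                                     (if-true (≡⇒≡ᵇ P P refl)) ⟨
      3 ^ P * c p + atP p ∎

    balance : weight unfired + pushed ≡ weight c + 3 ^ P * maxStable p
    balance = begin-equality
      weight unfired + pushed ≡⟨ ∑-distrib-+ (λ j → 3 ^ toℕ j * unfired j) (λ j → 3 ^ toℕ j * nb p j) ⟨
      sum (λ j → 3 ^ toℕ j * unfired j + 3 ^ toℕ j * nb p j) ≡⟨ sum-cong-≗ pointwise ⟩
      sum (λ j → 3 ^ toℕ j * c j + atP j)
        ≡⟨ ∑-distrib-+ (λ j → 3 ^ toℕ j * c j) atP ⟩
      weight c + sum atP ≡⟨ cong (_+_ (weight c)) (sum-indicator p (3 ^ P * maxStable p)) ⟩
      weight c + 3 ^ P * maxStable p ∎

    neighbour-term : 3 ^ suc P ≤ pushed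
    neighbour-term = subst (_≤ pushed) q-term (term≤sum (λ j → 3 ^ toℕ j * nb p j) q)
      where
      q : Fin (suc m)
      q = fromℕ< (s≤s p<m)
      q≡1+p : toℕ q ≡ suc P
      q≡1+p = toℕ-fromℕ< (s≤s p<m)
      q-term : 3 ^ toℕ q * nb p q ≡ 3 ^ suc P
      q-term = trans (cong₂ _*_ (cong (3 ^_) q≡1+p) (nb-adjacent (inj₁ q≡1+p))) (*-identityʳ _)

    p-term : 3 ^ P * maxStable p < 3 ^ suc P
    p-term = ≤-<-trans (*-monoʳ-≤ (3 ^ P) (maxStable≤2 p))
                       (subst (3 ^ P * 2 <_) (*-comm (3 ^ P) 3) (*-monoʳ-< (3 ^ P) {{m^n≢0 3 P}} (n<1+n 2)))

module _ {m : ℕ} where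

  reach-unforbidden : {c : Config m} → Stable c → ¬ Forbidden c → Reach onesThenZero c
  reach-unforbidden {c} = go (<-wellFounded (weight c))
    where
    go : ∀ {c} → Acc _<_ (weight c) → Stable c → ¬ Forbidden c → Reach onesThenZero c
    go {c} (acc lighter) st unf with any? (λ p → (toℕ p <? m) ×-dec (c p ≟ 0))
    ... | yes (p , p<m , cp≡0) =
      Reach-trans (go (lighter U.unfired-lighter) U.unfired-stable U.unfired-unforbidden) (ChainStep⇒Reach U.unfired-step)
      where module U = Unfire st unf cp≡0 p<m
    ... | no ∄zero = reach-≥ above st
      where
      above : ∀ j → onesThenZero j ≤ c j
      above j with toℕ j <? m
      ... | yes j<m = subst (_≤ c j) (sym (if-true (<⇒<ᵇ j<m))) (n≢0⇒n>0 (λ cj≡0 → ∄zero (j , j<m , cj≡0)))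
      ... | no  j≮m = subst (_≤ c j) (sym (if-false (j≮m ∘ <ᵇ⇒< _ _))) z≤n

  reach-maxStable : {c : Config m} → Stable c → Reach c maxStable
  reach-maxStable st = reach-≥ (≤-pred ∘ st) maxStable-stable

  recurrent⇒unforbidden : {c : Config m} → Recurrent c → ¬ Forbidden c
  recurrent⇒unforbidden (st , back) =
    maxStable-unforbidden ∘ Reach-reflects-forbidden (back maxStable maxStable-stable (reach-maxStable st))

  unforbidden⇒recurrent : {c : Config m} → Stable c → ¬ Forbidden c → Recurrent c
  unforbidden⇒recurrent st unf =
    st , λ d std _ → Reach-trans (reach-maxStable std) (Reach-trans maxStable-reaches-onesThenZero (reach-unforbidden st unf))

-- Φ_F as an automaton

stepAdmissible : Dir → ℕ → Bool
stepAdmissible toLeft  _       = true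
stepAdmissible toRight zero    = false
stepAdmissible toRight (suc _) = true

-- Running Φ_F from the orientation d never meets its excluded case (i - 1 → i and c_i = 0).
admissible : ∀ {k} → Dir → Vec ℕ k → Bool
admissible d []       = true
admissible d (x ∷ xs) = stepAdmissible d x ∧ admissible (next d x) xs

-- A forbidden interval whose left end is a zero just before the first vertex: the situation
-- that an incoming edge oriented toRight records.
ForbiddenFromStart : ∀ {m} → Config m → Set
ForbiddenFromStart {m} c = Σ (Fin (suc m)) λ b → c b ≡ 0 × (∀ i → toℕ i < toℕ b → c i ≤ 1)

forbidden-shift : ∀ {m} {c : Config (suc m)} → Forbidden (c ∘ F.suc) → Forbidden c
forbidden-shift (a , b , a<b , ca , cb , inner) =
  F.suc a , F.suc b , s≤s a<b , ca , cb , λ { (F.suc i) (s≤s a<i) (s≤s i<b) → inner i a<i i<b }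

inadmissible-∷ : ∀ {k} d x (xs : Vec ℕ k) → admissible (next d x) xs ≡ false → admissible d (x ∷ xs) ≡ false
inadmissible-∷ d x xs rest = trans (cong (stepAdmissible d x ∧_) rest) (∧-zeroʳ _)

forbidden⇒inadmissible : ∀ {m} (c : Config m) d → Forbidden c → admissible d (tabulate c) ≡ false
fromStart⇒inadmissible : ∀ {m} (c : Config m) → ForbiddenFromStart c → admissible toRight (tabulate c) ≡ false

forbidden⇒inadmissible c d (F.zero  , F.zero , () , _)
forbidden⇒inadmissible c d (F.suc _ , F.zero , () , _)
forbidden⇒inadmissible {suc m} c d (F.zero , F.suc b , _ , c0≡0 , cb≡0 , inner) =
  subst (λ x → admissible d (x ∷ tabulate (c ∘ F.suc)) ≡ false) (sym c0≡0) (zero-then d)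
  where
  zero-then : ∀ d → admissible d (0 ∷ tabulate (c ∘ F.suc)) ≡ false
  zero-then toLeft  = fromStart⇒inadmissible (c ∘ F.suc) (b , cb≡0 , λ i i<b → inner (F.suc i) z<s (s≤s i<b))
  zero-then toRight = refl
forbidden⇒inadmissible {suc m} c d (F.suc a , F.suc b , s≤s a<b , ca≡0 , cb≡0 , inner) =
  inadmissible-∷ d (c F.zero) (tabulate (c ∘ F.suc))
    (forbidden⇒inadmissible (c ∘ F.suc) (next d (c F.zero))
      (a , b , a<b , ca≡0 , cb≡0 , λ i a<i i<b → inner (F.suc i) (s≤s a<i) (s≤s i<b)))

fromStart⇒inadmissible c (F.zero , c0≡0 , _) =
  subst (λ x → admissible toRight (x ∷ tabulate (c ∘ F.suc)) ≡ false) (sym c0≡0) refl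
fromStart⇒inadmissible {suc m} c (F.suc b , cb≡0 , before) = first (c F.zero) (before F.zero z<s)
  where
  first : ∀ x → x ≤ 1 → admissible toRight (x ∷ tabulate (c ∘ F.suc)) ≡ false
  first zero       _ = refl
  first (suc zero) _ = fromStart⇒inadmissible (c ∘ F.suc) (b , cb≡0 , λ i i<b → before (F.suc i) (s≤s i<b))
  first (suc (suc _)) (s≤s ())

inadmissible⇒forbidden : ∀ {m} (c : Config m) d → (∀ i → c i ≤ 2) → admissible d (tabulate c) ≡ false →
  Forbidden c ⊎ (d ≡ toRight × ForbiddenFromStart c)
inadmissible⇒forbidden {zero} c d _ = single d (c F.zero) refl
  where
  single : ∀ d x → c F.zero ≡ x → admissible d (x ∷ []) ≡ false →
    Forbidden c ⊎ (d ≡ toRight × ForbiddenFromStart c)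
  single toRight zero    c0≡0 _ = inj₂ (refl , F.zero , c0≡0 , λ _ ())
  single toRight (suc _) _ ()
  single toLeft  _       _ ()
inadmissible⇒forbidden {suc m} c d bound = first d (c F.zero) refl (bound F.zero)
  where
  Result : Dir → Set
  Result d = Forbidden c ⊎ (d ≡ toRight × ForbiddenFromStart c)

  extend : ∀ d x → c F.zero ≡ x → x ≤ 2 → next d x ≡ toRight → ForbiddenFromStart (c ∘ F.suc) → Result d
  extend toLeft  zero       c0≡0 _ _ (b , cb≡0 , before) =
    inj₁ (F.zero , F.suc b , z<s , c0≡0 , cb≡0 , λ { (F.suc i) _ (s≤s i<b) → before i i<b })
  extend toRight zero       c0≡0 _ _ _ = inj₂ (refl , F.zero , c0≡0 , λ _ ())
  extend toRight (suc zero) c0≡1 _ _ (b , cb≡0 , before) =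
    inj₂ (refl , F.suc b , cb≡0 , λ { F.zero _ → ≤-reflexive c0≡1 ; (F.suc i) (s≤s i<b) → before i i<b })
  extend toLeft  (suc _)             _ _ () _
  extend toRight (suc (suc zero))    _ _ () _
  extend toRight (suc (suc (suc _))) _ (s≤s (s≤s ())) _ _

  rest : ∀ d x → c F.zero ≡ x → x ≤ 2 → admissible (next d x) (tabulate (c ∘ F.suc)) ≡ false → Result d
  rest d x c0≡x x≤2 inadm with inadmissible⇒forbidden (c ∘ F.suc) (next d x) (bound ∘ F.suc) inadm
  ... | inj₁ f                 = inj₁ (forbidden-shift f)
  ... | inj₂ (toRight≡ , from) = extend d x c0≡x x≤2 toRight≡ from

  first : ∀ d x → c F.zero ≡ x → x ≤ 2 → admissible d (x ∷ tabulate (c ∘ F.suc)) ≡ false → Result d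
  first toRight zero    c0≡0 _ _ = inj₂ (refl , F.zero , c0≡0 , λ _ ())
  first toRight (suc x) c0≡x   = rest toRight (suc x) c0≡x
  first toLeft  x       c0≡x   = rest toLeft x c0≡x

module _ {m : ℕ} {c : Config m} where

  recurrent⇒admissible : Recurrent c → admissible toLeft (tabulate c) ≡ true
  recurrent⇒admissible r@(st , _) with admissible toLeft (tabulate c) in adm
  ... | true  = refl
  ... | false with inadmissible⇒forbidden c toLeft (λ i → ≤-trans (≤-pred (st i)) (maxStable≤2 i)) adm
  ...   | inj₁ f       = ⊥-elim (recurrent⇒unforbidden r f)
  ...   | inj₂ (() , _)

  admissible⇒unforbidden : admissible toLeft (tabulate c) ≡ true → ¬ Forbidden c
  admissible⇒unforbidden adm f with trans (sym adm) (forbidden⇒inadmissible c toLeft f)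
  ... | ()

-- Decoding Φ_F

Bounded : ∀ {k} → Vec ℕ (suc k) → Set
Bounded {zero}  (x ∷ _)  = x ≤ 1
Bounded {suc k} (x ∷ xs) = x ≤ 2 × Bounded xs

mark : ∀ {k} → Dir → Vec ℕ (suc k) → Bool
mark d (x ∷ xs) = markOf d x (isEmpty xs)

bounded-tabulate : ∀ {m} (f : Fin (suc m) → ℕ) →
  (∀ j → f j ≤ suc (indicator (toℕ j <ᵇ m))) → Bounded (tabulate f)
bounded-tabulate {zero}  f h = h F.zero
bounded-tabulate {suc m} f h = h F.zero , bounded-tabulate (f ∘ F.suc) (h ∘ F.suc)

bounded-tabulate⁻¹ : ∀ {m} (f : Fin (suc m) → ℕ) →
  Bounded (tabulate f) → ∀ j → f j ≤ suc (indicator (toℕ j <ᵇ m))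
bounded-tabulate⁻¹ {zero}  f f0≤1     F.zero    = f0≤1
bounded-tabulate⁻¹ {suc m} f (f0≤2 , _) F.zero  = f0≤2
bounded-tabulate⁻¹ {suc m} f (_ , bs) (F.suc j) = bounded-tabulate⁻¹ (f ∘ F.suc) bs j

stable⇒bounded : ∀ {m} {c : Config m} → Stable c → Bounded (tabulate c)
stable⇒bounded {c = c} st =
  bounded-tabulate c λ j → ≤-trans (≤-pred (st j)) (+-monoˡ-≤ _ (indicator≤1 (0 <ᵇ toℕ j)))

stable⇒unmarked : ∀ {m} {c : Config m} → Stable c → mark toLeft (tabulate c) ≡ false
stable⇒unmarked {zero}  st = dec-false (_ ≟ 1) (<⇒≢ (st F.zero))
stable⇒unmarked {suc m} st = dec-false (_ ≟ 2) (<⇒≢ (st F.zero))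

bounded∧unmarked⇒stable : ∀ {m} {c : Config m} → Bounded (tabulate c) → mark toLeft (tabulate c) ≡ false → Stable c
bounded∧unmarked⇒stable {c = c} bnd _ (F.suc j) = s≤s (bounded-tabulate⁻¹ c bnd (F.suc j))
bounded∧unmarked⇒stable {zero}  c0≤1       unmarked F.zero = ≤∧≢⇒< c0≤1 (≡ᵇ≡false⇒≢ unmarked)
bounded∧unmarked⇒stable {suc m} (c0≤2 , _) unmarked F.zero = ≤∧≢⇒< c0≤2 (≡ᵇ≡false⇒≢ unmarked)

dirOf : Letter → Dir
dirOf R  = toRight
dirOf Lu = toLeft
dirOf Lm = toLeft

letter-dirOf : ∀ l → letter (dirOf l) (isLm l) ≡ l
letter-dirOf R  = refl
letter-dirOf Lu = refl
letter-dirOf Lm = refl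

CanFollow : Letter → Letter → Set
CanFollow Lm R = ⊥
CanFollow _  _ = ⊤

ProperlyMarked : ∀ {k} → Vec Letter k → Set
ProperlyMarked []           = ⊤
ProperlyMarked (_ ∷ [])     = ⊤
ProperlyMarked (l ∷ l′ ∷ w) = CanFollow l l′ × ProperlyMarked (l′ ∷ w)

properlyMarked-tail : ∀ {k l} (w : Vec Letter k) → ProperlyMarked (l ∷ w) → ProperlyMarked w
properlyMarked-tail []      _        = tt
properlyMarked-tail (_ ∷ _) (_ , pm) = pm

properlyMarked-Lu : ∀ {k} (w : Vec Letter k) → ProperlyMarked w → ProperlyMarked (Lu ∷ w)
properlyMarked-Lu []      _  = tt
properlyMarked-Lu (_ ∷ _) pm = tt , pm

-- The number of grains on vertex i, read off the letters of the edges {i-1, i} and {i, i+1}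
-- (the letter of the edge {0, 1} is Lu).  The pair Lm R never occurs in a properly marked word.
value : Letter → Letter → ℕ
value R  R  = 1
value R  Lu = 2
value R  Lm = 2
value Lu R  = 0
value Lu Lu = 1
value Lu Lm = 1
value Lm R  = 0
value Lm Lu = 2
value Lm Lm = 2

lastValue : Letter → ℕ
lastValue R  = 1
lastValue Lu = 0
lastValue Lm = 1

decode : ∀ {k} → Letter → Vec Letter k → Vec ℕ (suc k)
decode l []       = lastValue l ∷ []
decode l (l′ ∷ w) = value l l′ ∷ decode l′ w

next-value : ∀ l l′ → CanFollow l l′ → next (dirOf l) (value l l′) ≡ dirOf l′
next-value R  R  _ = refl
next-value R  Lu _ = refl
next-value R  Lm _ = refl
next-value Lu R  _ = refl
next-value Lu Lu _ = refl
next-value Lu Lm _ = refl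
next-value Lm Lu _ = refl
next-value Lm Lm _ = refl

mark-∷ : ∀ {k} d x (v : Vec ℕ (suc k)) → mark d (x ∷ v) ≡ markOf d x false
mark-∷ d x (_ ∷ _) = refl

phi-∷ : ∀ {k} d x (v : Vec ℕ (suc k)) → phi d (x ∷ v) ≡ letter (next d x) (mark (next d x) v) ∷ phi (next d x) v
phi-∷ d x (_ ∷ _) = refl

mark-value : ∀ l l′ → CanFollow l l′ → markOf (dirOf l) (value l l′) false ≡ isLm l
mark-value R  R  _ = refl
mark-value R  Lu _ = refl
mark-value R  Lm _ = refl
mark-value Lu R  _ = refl
mark-value Lu Lu _ = refl
mark-value Lu Lm _ = refl
mark-value Lm Lu _ = refl
mark-value Lm Lm _ = refl

mark-decode : ∀ {k} l (w : Vec Letter k) → ProperlyMarked (l ∷ w) → mark (dirOf l) (decode l w) ≡ isLm l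
mark-decode R  []       _        = refl
mark-decode Lu []       _        = refl
mark-decode Lm []       _        = refl
mark-decode l  (l′ ∷ w) (ok , _) = trans (mark-∷ (dirOf l) (value l l′) (decode l′ w)) (mark-value l l′ ok)

phi-decode : ∀ {k} l (w : Vec Letter k) → ProperlyMarked (l ∷ w) → phi (dirOf l) (decode l w) ≡ w
phi-decode l []       _         = refl
phi-decode {suc k} l (l′ ∷ w) (ok , pm) = begin
  phi (dirOf l) (value l l′ ∷ v)              ≡⟨ phi-∷ (dirOf l) (value l l′) v ⟩
  run (next (dirOf l) (value l l′))           ≡⟨ cong run (next-value l l′ ok) ⟩
  run (dirOf l′)                              ≡⟨ cong₂ _∷_ letter≡ (phi-decode l′ w pm) ⟩
  l′ ∷ w                                       ∎
  where
  open ≡-Reasoning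
  v : Vec ℕ (suc k)
  v = decode l′ w
  run : Dir → Vec Letter (suc k)
  run d = letter d (mark d v) ∷ phi d v
  letter≡ : letter (dirOf l′) (mark (dirOf l′) v) ≡ l′
  letter≡ = trans (cong (letter (dirOf l′)) (mark-decode l′ w pm)) (letter-dirOf l′)

stepAdmissible-value : ∀ l l′ → stepAdmissible (dirOf l) (value l l′) ≡ true
stepAdmissible-value R  R  = refl
stepAdmissible-value R  Lu = refl
stepAdmissible-value R  Lm = refl
stepAdmissible-value Lu _  = refl
stepAdmissible-value Lm _  = refl

admissible-decode : ∀ {k} l (w : Vec Letter k) → ProperlyMarked (l ∷ w) → admissible (dirOf l) (decode l w) ≡ true
admissible-decode R  []       _         = refl
admissible-decode Lu []       _         = refl
admissible-decode Lm []       _         = refl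
admissible-decode l  (l′ ∷ w) (ok , pm) =
  cong₂ _∧_ (stepAdmissible-value l l′)
    (trans (cong (λ d → admissible d (decode l′ w)) (next-value l l′ ok)) (admissible-decode l′ w pm))

bounded-decode : ∀ {k} l (w : Vec Letter k) → Bounded (decode l w)
bounded-decode l []       = lastValue≤1 l
  where
  lastValue≤1 : ∀ l → lastValue l ≤ 1
  lastValue≤1 R  = ≤-refl
  lastValue≤1 Lu = z≤n
  lastValue≤1 Lm = ≤-refl
bounded-decode l (l′ ∷ w) = value≤2 l l′ , bounded-decode l′ w
  where
  value≤2 : ∀ l l′ → value l l′ ≤ 2
  value≤2 R  R  = s≤s z≤n
  value≤2 R  Lu = ≤-refl
  value≤2 R  Lm = ≤-refl
  value≤2 Lu R  = z≤n
  value≤2 Lu Lu = s≤s z≤n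
  value≤2 Lu Lm = s≤s z≤n
  value≤2 Lm R  = z≤n
  value≤2 Lm Lu = ≤-refl
  value≤2 Lm Lm = ≤-refl

value-letter : ∀ d x mk → x ≤ 2 → stepAdmissible d x ≡ true →
  value (letter d (markOf d x false)) (letter (next d x) mk) ≡ x
value-letter toLeft  0 _     _ _ = refl
value-letter toLeft  1 false _ _ = refl
value-letter toLeft  1 true  _ _ = refl
value-letter toLeft  2 false _ _ = refl
value-letter toLeft  2 true  _ _ = refl
value-letter toRight 1 _     _ _ = refl
value-letter toRight 2 false _ _ = refl
value-letter toRight 2 true  _ _ = refl
value-letter toRight 0 _ _ ()
value-letter _ (suc (suc (suc _))) _ (s≤s (s≤s ())) _

decode-phi : ∀ {k} d (v : Vec ℕ (suc k)) → admissible d v ≡ true → Bounded v →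
  decode (letter d (mark d v)) (phi d v) ≡ v
decode-phi toLeft  (0 ∷ [])     _ _ = refl
decode-phi toLeft  (1 ∷ [])     _ _ = refl
decode-phi toRight (1 ∷ [])     _ _ = refl
decode-phi toRight (0 ∷ [])     () _
decode-phi _ (suc (suc _) ∷ []) _ (s≤s ())
decode-phi d (x ∷ y ∷ v) adm (x≤2 , bnd) =
  cong₂ _∷_ (value-letter d x (mark (next d x) (y ∷ v)) x≤2 (∧-conicalˡ (stepAdmissible d x) _ adm))
            (decode-phi (next d x) (y ∷ v) (∧-conicalʳ (stepAdmissible d x) _ adm) bnd)

canFollow-letter : ∀ d x mk → CanFollow (letter d (markOf d x false)) (letter (next d x) mk)
canFollow-letter toRight _ _ = tt
canFollow-letter toLeft  2 false = tt
canFollow-letter toLeft  2 true  = tt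
canFollow-letter toLeft  0 _ = tt
canFollow-letter toLeft  1 _ = tt
canFollow-letter toLeft  (suc (suc (suc _))) _ = tt

phi-properlyMarked : ∀ {k} d (v : Vec ℕ (suc k)) → ProperlyMarked (letter d (mark d v) ∷ phi d v)
phi-properlyMarked d (_ ∷ [])    = tt
phi-properlyMarked d (x ∷ y ∷ v) =
  canFollow-letter d x (mark (next d x) (y ∷ v)) , phi-properlyMarked (next d x) (y ∷ v)

-- Subgraphs of the path

letterOf : Bool → Bool → Letter
letterOf _     true  = Lm
letterOf true  false = Lu
letterOf false false = R

letterOf-isL : ∀ l → letterOf (isL l) (isLm l) ≡ l
letterOf-isL R  = refl
letterOf-isL Lu = refl
letterOf-isL Lm = refl

isL-letterOf : ∀ b e → (e ≡ true → b ≡ true) → isL (letterOf b e) ≡ b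
isL-letterOf b     true  e⇒b = sym (e⇒b refl)
isL-letterOf true  false _   = refl
isL-letterOf false false _   = refl

isLm-letterOf : ∀ b e → isLm (letterOf b e) ≡ e
isLm-letterOf _     true  = refl
isLm-letterOf true  false = refl
isLm-letterOf false false = refl

there⁻ : ∀ {A : Set} {k} {x y : A} {xs : Vec A k} {i} → (y ∷ xs) [ F.suc i ]= x → xs [ i ]= x
there⁻ (there p) = p

T-first-edge : ∀ {k} l (w : Vec Letter k) → ProperlyMarked (l ∷ w) → proj₂ (T (l ∷ w)) [ F.zero ]= true →
  proj₁ (T (l ∷ w)) [ F.zero ]= true × proj₁ (T (l ∷ w)) [ F.suc F.zero ]= true
T-first-edge Lm []       _        here = here , there here
T-first-edge Lm (Lu ∷ _) _        here = here , there here
T-first-edge Lm (Lm ∷ _) _        here = here , there here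
T-first-edge Lm (R ∷ _)  (() , _) here

T-target : ∀ {m} (w : Vec Letter m) → ProperlyMarked w → IsTargetSubgraph (T w)
T-target []      _  = (λ ()) , here
T-target (l ∷ w) pm = edges , there (proj₂ rest)
  where
  rest : IsTargetSubgraph (T w)
  rest = T-target w (properlyMarked-tail w pm)
  edges : IsSubgraph (proj₁ (T (l ∷ w))) (proj₂ (T (l ∷ w)))
  edges F.zero    e∈         = T-first-edge l w pm e∈
  edges (F.suc i) (there e∈) = Product.map there there (proj₁ rest i e∈)

T-injective : ∀ {m} (w w′ : Vec Letter m) → T w ≡ T w′ → w ≡ w′
T-injective []      []        _    = refl
T-injective (l ∷ w) (l′ ∷ w′) Tw≡ =
  cong₂ _∷_ l≡l′ (T-injective w w′ (cong₂ _,_ (∷-injectiveʳ V≡) (∷-injectiveʳ E≡)))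
  where
  V≡ : proj₁ (T (l ∷ w)) ≡ proj₁ (T (l′ ∷ w′))
  V≡ = cong proj₁ Tw≡
  E≡ : proj₂ (T (l ∷ w)) ≡ proj₂ (T (l′ ∷ w′))
  E≡ = cong proj₂ Tw≡
  l≡l′ : l ≡ l′
  l≡l′ = trans (sym (letterOf-isL l))
               (trans (cong₂ letterOf (∷-injectiveˡ V≡) (∷-injectiveˡ E≡)) (letterOf-isL l′))

canFollow-letterOf : ∀ b e l′ → (e ≡ true → isL l′ ≡ true) → CanFollow (letterOf b e) l′
canFollow-letterOf _     true  Lu _   = tt
canFollow-letterOf _     true  Lm _   = tt
canFollow-letterOf _     true  R  e⇒L with e⇒L refl
... | ()
canFollow-letterOf true  false _  _   = tt
canFollow-letterOf false false _  _   = tt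

properlyMarked-letterOf : ∀ {k} b e (w : Vec Letter k) → ProperlyMarked w →
  (e ≡ true → lookup (proj₁ (T w)) F.zero ≡ true) → ProperlyMarked (letterOf b e ∷ w)
properlyMarked-letterOf b e []       _  _   = tt
properlyMarked-letterOf b e (l′ ∷ w) pm e⇒L = canFollow-letterOf b e l′ e⇒L , pm

target-tail : ∀ {m b e} {Vs : Vec Bool (suc m)} {Es : Vec Bool m} →
  IsTargetSubgraph (b ∷ Vs , e ∷ Es) → IsTargetSubgraph (Vs , Es)
target-tail (sub , last) = (λ i i∈ → Product.map there⁻ there⁻ (sub (F.suc i) (there i∈))) , there⁻ last

target-first-edge : ∀ {m b e} {Vs : Vec Bool (suc m)} {Es : Vec Bool m} →
  IsTargetSubgraph (b ∷ Vs , e ∷ Es) → e ≡ true → b ≡ true × lookup Vs F.zero ≡ true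
target-first-edge (sub , _) refl = Product.map []=⇒lookup ([]=⇒lookup ∘ there⁻) (sub F.zero here)

T-surjective : ∀ {m} (G : Subset′ m) → IsTargetSubgraph G → Σ (Vec Letter m) λ w → ProperlyMarked w × T w ≡ G
T-surjective {zero}  (b ∷ [] , []) (_ , here) = [] , tt , refl
T-surjective {suc m} (b ∷ Vs , e ∷ Es) target with T-surjective (Vs , Es) (target-tail target)
... | w , pm , Tw≡ =
  letterOf b e ∷ w ,
  properlyMarked-letterOf b e w pm head-in ,
  cong₂ _,_ (cong₂ _∷_ (isL-letterOf b e (proj₁ ∘ ends)) (cong proj₁ Tw≡))
            (cong₂ _∷_ (isLm-letterOf b e) (cong proj₂ Tw≡))
  where
  ends : e ≡ true → b ≡ true × lookup Vs F.zero ≡ true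
  ends = target-first-edge target
  head-in : e ≡ true → lookup (proj₁ (T w)) F.zero ≡ true
  head-in e≡true = trans (cong (λ G → lookup (proj₁ G) F.zero) Tw≡) (proj₂ (ends e≡true))

-- The level

edges-∷ : ∀ {k} l (w : Vec Letter k) → ∣ V.map isLm (l ∷ w) ∣ ≡ indicator (isLm l) + ∣ V.map isLm w ∣
edges-∷ R  _ = refl
edges-∷ Lu _ = refl
edges-∷ Lm _ = refl

value-balance : ∀ l l′ → CanFollow l l′ →
  value l l′ + indicator (isL l) ≡ suc (indicator (isLm l) + indicator (isL l′))
value-balance R  R  _ = refl
value-balance R  Lu _ = refl
value-balance R  Lm _ = refl
value-balance Lu R  _ = refl
value-balance Lu Lu _ = refl
value-balance Lu Lm _ = refl
value-balance Lm Lu _ = refl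
value-balance Lm Lm _ = refl

-- Summing value-balance along the word telescopes.
decode-sum : ∀ {k} l (w : Vec Letter k) → ProperlyMarked (l ∷ w) →
  V.sum (decode l w) + indicator (isL l) ≡ suc (indicator (isLm l) + (∣ V.map isLm w ∣ + k))
decode-sum R  []       _ = refl
decode-sum Lu []       _ = refl
decode-sum Lm []       _ = refl
decode-sum {suc k} l (l′ ∷ w) (ok , pm) = begin
  value l l′ + S + a             ≡⟨ swap (value l l′) S a ⟩
  value l l′ + a + S             ≡⟨ cong (_+ S) (value-balance l l′ ok) ⟩
  suc (b + a′) + S               ≡⟨ shift b a′ S ⟩
  suc (b + (S + a′))             ≡⟨ cong (λ t → suc (b + t)) (decode-sum l′ w pm) ⟩
  suc (b + suc (b′ + (E + k)))   ≡⟨ cong (λ t → suc (b + t)) (regroup b′ E k) ⟩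
  suc (b + (b′ + E + suc k))     ≡⟨ cong (λ t → suc (b + (t + suc k))) (edges-∷ l′ w) ⟨
  suc (b + (∣ V.map isLm (l′ ∷ w) ∣ + suc k)) ∎
  where
  open ≡-Reasoning
  S E a a′ b b′ : ℕ
  S  = V.sum (decode l′ w)
  E  = ∣ V.map isLm w ∣
  a  = indicator (isL l)
  a′ = indicator (isL l′)
  b  = indicator (isLm l)
  b′ = indicator (isLm l′)
  swap : ∀ x y z → x + y + z ≡ x + z + y
  swap = solve-∀
  shift : ∀ x y z → suc (x + y) + z ≡ suc (x + (z + y))
  shift = solve-∀
  regroup : ∀ x y z → suc (x + (y + z)) ≡ x + y + suc z
  regroup = solve-∀

level-from-sum : ∀ s e m → s ≡ e + m → (+ s ℤ.- + suc m) ℤ.+ + 1 ≡ + e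
level-from-sum _ e m refl = begin
  (+ (e + m) ℤ.- + suc m) ℤ.+ + 1             ≡⟨ cong₂ (λ x y → (x ℤ.- y) ℤ.+ + 1) (pos-+ e m) (pos-+ 1 m) ⟩
  ((+ e ℤ.+ + m) ℤ.- (+ 1 ℤ.+ + m)) ℤ.+ + 1 ≡⟨ cancel (+ e) (+ m) ⟩
  + e ∎
  where
  open ≡-Reasoning
  cancel : ∀ x y → ((x ℤ.+ y) ℤ.- (+ 1 ℤ.+ y)) ℤ.+ + 1 ≡ x
  cancel = ℤ-Solver.solve-∀

ΦF-properlyMarked : ∀ {m} (c : Config m) → ProperlyMarked (ΦF c)
ΦF-properlyMarked c = properlyMarked-tail (ΦF c) (phi-properlyMarked toLeft (tabulate c))

module _ {m : ℕ} where

  decode-ΦF : {c : Config m} → Recurrent c → decode Lu (ΦF c) ≡ tabulate c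
  decode-ΦF {c} r@(st , _) =
    subst (λ mk → decode (letter toLeft mk) (ΦF c) ≡ tabulate c) (stable⇒unmarked st)
      (decode-phi toLeft (tabulate c) (recurrent⇒admissible r) (stable⇒bounded st))

  ΦF-injective : {c c′ : Config m} → Recurrent c → Recurrent c′ → ΦF c ≡ ΦF c′ → c ≗ c′
  ΦF-injective {c} {c′} r r′ ΦFc≡ i = begin
    c i                    ≡⟨ lookup∘tabulate c i ⟨
    lookup (tabulate c) i  ≡⟨ cong (λ v → lookup v i) tabulate≡ ⟩
    lookup (tabulate c′) i ≡⟨ lookup∘tabulate c′ i ⟩
    c′ i                   ∎
    where
    open ≡-Reasoning
    tabulate≡ : tabulate c ≡ tabulate c′
    tabulate≡ = trans (sym (decode-ΦF r)) (trans (cong (decode Lu) ΦFc≡) (decode-ΦF r′))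

  ΦF-surjective : (w : Vec Letter m) → ProperlyMarked w → Σ (Config m) λ c → Recurrent c × ΦF c ≡ w
  ΦF-surjective w pm = c , unforbidden⇒recurrent stable unforbidden , trans (cong (phi toLeft) c≡) (phi-decode Lu w pm′)
    where
    pm′ : ProperlyMarked (Lu ∷ w)
    pm′ = properlyMarked-Lu w pm
    c : Config m
    c = lookup (decode Lu w)
    c≡ : tabulate c ≡ decode Lu w
    c≡ = tabulate∘lookup (decode Lu w)
    stable : Stable c
    stable = bounded∧unmarked⇒stable (subst Bounded (sym c≡) (bounded-decode Lu w))
                                     (trans (cong (mark toLeft) c≡) (mark-decode Lu w pm′))
    unforbidden : ¬ Forbidden c
    unforbidden = admissible⇒unforbidden (trans (cong (admissible toLeft) c≡) (admissible-decode Lu w pm′))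

  level≡edges : {c : Config m} → Recurrent c → level c ≡ + ∣ V.map isLm (ΦF c) ∣
  level≡edges {c} r = level-from-sum (V.sum (tabulate c)) ∣ V.map isLm (ΦF c) ∣ m (+-cancelʳ-≡ 1 _ _ sum+1)
    where
    sum+1 : V.sum (tabulate c) + 1 ≡ ∣ V.map isLm (ΦF c) ∣ + m + 1
    sum+1 = begin
      V.sum (tabulate c) + 1 ≡⟨ cong (λ v → V.sum v + 1) (decode-ΦF r) ⟨
      V.sum (decode Lu (ΦF c)) + 1 ≡⟨ decode-sum Lu (ΦF c) (properlyMarked-Lu (ΦF c) (ΦF-properlyMarked c)) ⟩
      suc (∣ V.map isLm (ΦF c) ∣ + m) ≡⟨ +-comm 1 _ ⟩
      ∣ V.map isLm (ΦF c) ∣ + m + 1 ∎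
      where open ≡-Reasoning

theorem5p6 : (m : ℕ) →
    -- T ∘ Φ_F maps recurrent configurations on F_(suc m) to subgraphs of P_(suc m) containing suc m
    ((c : Config m) → Recurrent c → IsTargetSubgraph (T (ΦF c)))
    -- injective
    × ((c c′ : Config m) → Recurrent c → Recurrent c′ → T (ΦF c) ≡ T (ΦF c′) → c ≗ c′)
    -- surjective
    × ((G : Subset′ m) → IsTargetSubgraph G → Σ (Config m) λ c → Recurrent c × T (ΦF c) ≡ G)
    -- level = number of edges
    × ((c : Config m) → Recurrent c → level c ≡ + ∣ proj₂ (T (ΦF c)) ∣)
theorem5p6 m = into , injective , surjective , λ _ → level≡edges
  where
  into : (c : Config m) → Recurrent c → IsTargetSubgraph (T (ΦF c))
  into c _ = T-target (ΦF c) (ΦF-properlyMarked c)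

  injective : (c c′ : Config m) → Recurrent c → Recurrent c′ → T (ΦF c) ≡ T (ΦF c′) → c ≗ c′
  injective c c′ r r′ = ΦF-injective r r′ ∘ T-injective (ΦF c) (ΦF c′)

  surjective : (G : Subset′ m) → IsTargetSubgraph G → Σ (Config m) λ c → Recurrent c × T (ΦF c) ≡ G
  surjective G target with T-surjective G target
  ... | w , pm , Tw≡G with ΦF-surjective w pm
  ...   | c , r , ΦFc≡w = c , r , trans (cong T ΦFc≡w) Tw≡G
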